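{- As formal power series (equivalently, entire functions) in $x$, $$c_1^3e^{\alpha x}+c_2^3e^{\beta x}+c_3^3e^{\gamma x}=\frac{1}{44}\sum_{n=0}^\infty T_n^{(3,3,5)}\frac{x^n}{n!}.$$
   Context: Let $\alpha,\beta,\gamma$ be the three distinct complex roots of $x^3-x^2-x-1=0$, and set $c_1=\frac{\alpha}{(\alpha-\beta)(\alpha-\gamma)}$, $c_2=\frac{\beta}{(\beta-\alpha)(\beta-\gamma)}$, $c_3=\frac{\gamma}{(\gamma-\alpha)(\gamma-\beta)}$. For numbers $s_0,s_1,s_2$, the sequence $T_n^{(s_0,s_1,s_2)}$ is defined by $T_0^{(s_0,s_1,s_2)}=s_0$, $T_1^{(s_0,s_1,s_2)}=s_1$, $T_2^{(s_0,s_1,s_2)}=s_2$ and $T_n^{(s_0,s_1,s_2)}=T_{n-1}^{(s_0,s_1,s_2)}+T_{n-2}^{(s_0,s_1,s_2)}+T_{n-3}^{(s_0,s_1,s_2)}$ for $n\ge3$. -}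

module Defs where

open import Level using (Level; _⊔_) renaming (suc to lsuc)
open import Data.Nat using (ℕ; zero; suc)
open import Data.Product using (Σ; _×_)
open import Relation.Nullary using (¬_)
open import Relation.Binary.PropositionalEquality using (_≡_)
open import Algebra.Bundles using (CommutativeRing)

record Field (c ℓ : Level) : Set (lsuc (c ⊔ ℓ)) where
  field
    commutativeRing : CommutativeRing c ℓ
  open CommutativeRing commutativeRing public
  field
    0≉1     : ¬ (0# ≈ 1#)
    inverse : ∀ x → ¬ (x ≈ 0#) → Σ Carrier (λ y → x * y ≈ 1#)

module _ {c ℓ : Level} (F : Field c ℓ) where
  open Field F

  fromℕ : ℕ → Carrier
  fromℕ zero    = 0#
  fromℕ (suc n) = 1# + fromℕ n

  pow : Carrier → ℕ → Carrier
  pow x zero    = 1#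
  pow x (suc n) = x * pow x n

  CharZero : Set ℓ
  CharZero = ∀ n → fromℕ (suc n) ≈ 0# → Data.Empty.⊥
    where import Data.Empty

  T : Carrier → Carrier → Carrier → ℕ → Carrier
  T s0 s1 s2 zero                   = s0
  T s0 s1 s2 (suc zero)             = s1
  T s0 s1 s2 (suc (suc zero))       = s2
  T s0 s1 s2 (suc (suc (suc n)))    =
    T s0 s1 s2 (suc (suc n)) + T s0 s1 s2 (suc n) + T s0 s1 s2 n

  IsRoot : Carrier → Set ℓ
  IsRoot a = pow a 3 - pow a 2 - a - 1# ≈ 0#

-- Write f = x³ − x² − x − 1. For three distinct roots, Vieta gives α + β + γ = 1 and
-- αβ + βγ + γα = −1, hence (α − β)(α − γ) = f′(α). Modulo f one has
-- f′(x)(10x² − 6x − 8) ≡ 44x, so 44 c₁ = 10α² − 6α − 8, and cubing and reducing again,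
-- 44² c₁³ = 28 − 12α + 20α². Summing over the roots, 44² Σ cᵢ³ αᵢⁿ = 28 pₙ − 12 pₙ₊₁ + 20 pₙ₊₂
-- for the power sums pₙ = αⁿ + βⁿ + γⁿ. These satisfy the tribonacci recurrence with
-- p₀, p₁, p₂ = 3, 1, 3, and a tribonacci sequence is determined by its first three terms,
-- so 28 pₙ − 12 pₙ₊₁ + 20 pₙ₊₂ = 44 Tₙ^(3,3,5) follows by comparing three initial values.
module Submission where

open import Defs
open import Level using (0ℓ)
open import Data.Nat as ℕ using (ℕ; zero; suc)
open import Data.Maybe using (just; nothing)
open import Data.Product using (_,_)
open import Function using (_∘_)
open import Relation.Nullary using (¬_; yes)
open import Relation.Binary.Definitions using (WeaklyDecidable)
open import Relation.Binary.PropositionalEquality as ≡ using (_≡_)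
open import Algebra.Bundles using (CommutativeRing; RawRing)
open import Algebra.Solver.Ring.AlmostCommutativeRing
  using (fromCommutativeRing; _-Raw-AlmostCommutative⟶_)
import Algebra.Solver.Ring
import Algebra.Solver.Ring.NaturalCoefficients.Default as NaturalCoefficientSolver
import Algebra.Properties.Ring as RingProperties
import Algebra.Properties.Semiring.Mult as SemiringMultiplication
import Relation.Binary.Reasoning.Setoid as SetoidReasoning

-- m ⊖ n stands for the integer m − n. The solver compares normal forms up to
-- definitional equality, so coefficient arithmetic must return canonical representatives.
data Difference : Set where
  _⊖_ : ℕ → ℕ → Difference

normalize : Difference → Difference
normalize (suc m ⊖ suc n) = normalize (m ⊖ n)
normalize d               = d

differences : RawRing 0ℓ 0ℓ
differences = record
  { Carrier = Difference
  ; _≈_     = _≡_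
  ; _+_     = λ { (m ⊖ n) (m′ ⊖ n′) → normalize ((m ℕ.+ m′) ⊖ (n ℕ.+ n′)) }
  ; _*_     = λ { (m ⊖ n) (m′ ⊖ n′) →
                  normalize ((m ℕ.* m′ ℕ.+ n ℕ.* n′) ⊖ (m ℕ.* n′ ℕ.+ n ℕ.* m′)) }
  ; -_      = λ { (m ⊖ n) → n ⊖ m }
  ; 0#      = 0 ⊖ 0
  ; 1#      = 1 ⊖ 0
  }

module IntegerCoefficientSolver {r ℓ} (R : CommutativeRing r ℓ) where
  open CommutativeRing R
  open RingProperties ring using (-0#≈0#; ⁻¹-anti-homo‿-)
  open SemiringMultiplication semiring using (_×_; ×-homo-+; ×1-homo-*)
  open SetoidReasoning setoid

  -- Literals k ≥ 2 unfold to fromℕ k, and 1 is read as 1# itself, so solver statements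
  -- can be written with fromℕ k and 1# and still be checked by refl.
  ι : ℕ → Carrier
  ι (suc zero) = 1#
  ι n          = n × 1#

  ⟦_⟧ᵈ : Difference → Carrier
  ⟦ m     ⊖ zero  ⟧ᵈ = ι m
  ⟦ zero  ⊖ suc n ⟧ᵈ = - ι (suc n)
  ⟦ suc m ⊖ suc n ⟧ᵈ = ⟦ m ⊖ n ⟧ᵈ

  ι≈×1 : ∀ n → ι n ≈ n × 1#
  ι≈×1 zero          = refl
  ι≈×1 (suc zero)    = sym (+-identityʳ 1#)
  ι≈×1 (suc (suc n)) = refl

  x≈[x-y]+y : ∀ x y → x ≈ (x - y) + y
  x≈[x-y]+y x y = begin
    x               ≈⟨ +-identityʳ x ⟨
    x + 0#          ≈⟨ +-congˡ (-‿inverseˡ y) ⟨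
    x + (- y + y)   ≈⟨ +-assoc x (- y) y ⟨
    x - y + y       ∎

  x≈u+y⇒x-y≈u : ∀ {x y u} → x ≈ u + y → x - y ≈ u
  x≈u+y⇒x-y≈u {x} {y} {u} x≈u+y = begin
    x - y         ≈⟨ +-congʳ x≈u+y ⟩
    u + y - y     ≈⟨ +-assoc u y (- y) ⟩
    u + (y - y)   ≈⟨ +-congˡ (-‿inverseʳ y) ⟩
    u + 0#        ≈⟨ +-identityʳ u ⟩
    u             ∎

  [a+b]-[c+d]≈[a-c]+[b-d] : ∀ a b c d → (a + b) - (c + d) ≈ (a - c) + (b - d)
  [a+b]-[c+d]≈[a-c]+[b-d] a b c d = x≈u+y⇒x-y≈u (begin
    a + b                         ≈⟨ +-cong (x≈[x-y]+y a c) (x≈[x-y]+y b d) ⟩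
    (a - c + c) + (b - d + d)     ≈⟨ solve 4 (λ u c v d → (u :+ c) :+ (v :+ d) := (u :+ v) :+ (c :+ d))
                                           refl (a - c) c (b - d) d ⟩
    (a - c) + (b - d) + (c + d)   ∎)
    where open NaturalCoefficientSolver commutativeSemiring using (solve; _:=_; _:+_)

  [ac+bd]-[ad+bc]≈[a-b][c-d] : ∀ a b c d → (a * c + b * d) - (a * d + b * c) ≈ (a - b) * (c - d)
  [ac+bd]-[ad+bc]≈[a-b][c-d] a b c d = x≈u+y⇒x-y≈u (begin
    a * c + b * d                         ≈⟨ +-congʳ (*-cong a≈u+b c≈v+d) ⟩
    (u + b) * (v + d) + b * d             ≈⟨ solve 4 (λ u b v d → (u :+ b) :* (v :+ d) :+ b :* d
                                                              := u :* v :+ ((u :+ b) :* d :+ b :* (v :+ d)))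
                                                   refl u b v d ⟩
    u * v + ((u + b) * d + b * (v + d))   ≈⟨ +-congˡ (+-cong (*-congʳ a≈u+b) (*-congˡ c≈v+d)) ⟨
    u * v + (a * d + b * c)               ∎)
    where
    open NaturalCoefficientSolver commutativeSemiring using (solve; _:=_; _:+_; _:*_)
    u v : Carrier
    u = a - b
    v = c - d
    a≈u+b : a ≈ u + b
    a≈u+b = x≈[x-y]+y a b
    c≈v+d : c ≈ v + d
    c≈v+d = x≈[x-y]+y c d

  ⟦m⊖n⟧≈m-n : ∀ m n → ⟦ m ⊖ n ⟧ᵈ ≈ m × 1# - n × 1#
  ⟦m⊖n⟧≈m-n m zero = begin
    ι m             ≈⟨ ι≈×1 m ⟩
    m × 1#          ≈⟨ +-identityʳ (m × 1#) ⟨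
    m × 1# + 0#     ≈⟨ +-congˡ -0#≈0# ⟨
    m × 1# - 0#     ∎
  ⟦m⊖n⟧≈m-n zero (suc n) = begin
    - ι (suc n)         ≈⟨ -‿cong (ι≈×1 (suc n)) ⟩
    - (suc n × 1#)      ≈⟨ +-identityˡ _ ⟨
    0# - suc n × 1#     ∎
  ⟦m⊖n⟧≈m-n (suc m) (suc n) = begin
    ⟦ m ⊖ n ⟧ᵈ                          ≈⟨ ⟦m⊖n⟧≈m-n m n ⟩
    m × 1# - n × 1#                     ≈⟨ +-identityˡ _ ⟨
    0# + (m × 1# - n × 1#)              ≈⟨ +-congʳ (-‿inverseʳ 1#) ⟨
    (1# - 1#) + (m × 1# - n × 1#)       ≈⟨ [a+b]-[c+d]≈[a-c]+[b-d] 1# (m × 1#) 1# (n × 1#) ⟨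
    (1# + m × 1#) - (1# + n × 1#)       ∎

  ⟦normalize-d⟧≈⟦d⟧ : ∀ d → ⟦ normalize d ⟧ᵈ ≈ ⟦ d ⟧ᵈ
  ⟦normalize-d⟧≈⟦d⟧ (suc m ⊖ suc n) = ⟦normalize-d⟧≈⟦d⟧ (m ⊖ n)
  ⟦normalize-d⟧≈⟦d⟧ (zero  ⊖ n)     = refl
  ⟦normalize-d⟧≈⟦d⟧ (suc m ⊖ zero)  = refl

  ⟦⟧-morphism : differences -Raw-AlmostCommutative⟶ fromCommutativeRing R
  ⟦⟧-morphism = record
    { ⟦_⟧    = ⟦_⟧ᵈ
    ; +-homo = +-homo
    ; *-homo = *-homo
    ; -‿homo = -‿homo
    ; 0-homo = refl
    ; 1-homo = refl
    }
    where
    +-homo : ∀ d d′ → ⟦ RawRing._+_ differences d d′ ⟧ᵈ ≈ ⟦ d ⟧ᵈ + ⟦ d′ ⟧ᵈ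
    +-homo (m ⊖ n) (m′ ⊖ n′) = begin
      ⟦ normalize ((m ℕ.+ m′) ⊖ (n ℕ.+ n′)) ⟧ᵈ  ≈⟨ ⟦normalize-d⟧≈⟦d⟧ ((m ℕ.+ m′) ⊖ (n ℕ.+ n′)) ⟩
      ⟦ (m ℕ.+ m′) ⊖ (n ℕ.+ n′) ⟧ᵈ              ≈⟨ ⟦m⊖n⟧≈m-n (m ℕ.+ m′) (n ℕ.+ n′) ⟩
      (m ℕ.+ m′) × 1# - (n ℕ.+ n′) × 1#         ≈⟨ +-cong (×-homo-+ 1# m m′) (-‿cong (×-homo-+ 1# n n′)) ⟩
      (m × 1# + m′ × 1#) - (n × 1# + n′ × 1#)   ≈⟨ [a+b]-[c+d]≈[a-c]+[b-d] _ _ _ _ ⟩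
      (m × 1# - n × 1#) + (m′ × 1# - n′ × 1#)   ≈⟨ +-cong (⟦m⊖n⟧≈m-n m n) (⟦m⊖n⟧≈m-n m′ n′) ⟨
      ⟦ m ⊖ n ⟧ᵈ + ⟦ m′ ⊖ n′ ⟧ᵈ                  ∎
    *-homo : ∀ d d′ → ⟦ RawRing._*_ differences d d′ ⟧ᵈ ≈ ⟦ d ⟧ᵈ * ⟦ d′ ⟧ᵈ
    *-homo (m ⊖ n) (m′ ⊖ n′) = begin
      ⟦ normalize (p ⊖ q) ⟧ᵈ                   ≈⟨ ⟦normalize-d⟧≈⟦d⟧ (p ⊖ q) ⟩
      ⟦ p ⊖ q ⟧ᵈ                               ≈⟨ ⟦m⊖n⟧≈m-n p q ⟩
      p × 1# - q × 1#                          ≈⟨ +-cong (×-homo-+ 1# (m ℕ.* m′) (n ℕ.* n′))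
                                                         (-‿cong (×-homo-+ 1# (m ℕ.* n′) (n ℕ.* m′))) ⟩
      ((m ℕ.* m′) × 1# + (n ℕ.* n′) × 1#) - ((m ℕ.* n′) × 1# + (n ℕ.* m′) × 1#)
        ≈⟨ +-cong (+-cong (×1-homo-* m m′) (×1-homo-* n n′))
                  (-‿cong (+-cong (×1-homo-* m n′) (×1-homo-* n m′))) ⟩
      (M * M′ + N * N′) - (M * N′ + N * M′)    ≈⟨ [ac+bd]-[ad+bc]≈[a-b][c-d] M N M′ N′ ⟩
      (M - N) * (M′ - N′)                      ≈⟨ *-cong (⟦m⊖n⟧≈m-n m n) (⟦m⊖n⟧≈m-n m′ n′) ⟨
      ⟦ m ⊖ n ⟧ᵈ * ⟦ m′ ⊖ n′ ⟧ᵈ                ∎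
      where
      p q : ℕ
      p = m ℕ.* m′ ℕ.+ n ℕ.* n′
      q = m ℕ.* n′ ℕ.+ n ℕ.* m′
      M N M′ N′ : Carrier
      M  = m × 1#
      N  = n × 1#
      M′ = m′ × 1#
      N′ = n′ × 1#
    -‿homo : ∀ d → ⟦ RawRing.-_ differences d ⟧ᵈ ≈ - ⟦ d ⟧ᵈ
    -‿homo (m ⊖ n) = begin
      ⟦ n ⊖ m ⟧ᵈ              ≈⟨ ⟦m⊖n⟧≈m-n n m ⟩
      n × 1# - m × 1#         ≈⟨ ⁻¹-anti-homo‿- (m × 1#) (n × 1#) ⟨
      - (m × 1# - n × 1#)     ≈⟨ -‿cong (⟦m⊖n⟧≈m-n m n) ⟨
      - ⟦ m ⊖ n ⟧ᵈ            ∎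

  ⟦⟧-≟ : WeaklyDecidable (λ d d′ → ⟦ d ⟧ᵈ ≈ ⟦ d′ ⟧ᵈ)
  ⟦⟧-≟ (m ⊖ n) (m′ ⊖ n′) with m ℕ.≟ m′ | n ℕ.≟ n′
  ... | yes ≡.refl | yes ≡.refl = just refl
  ... | _          | _          = nothing

  open Algebra.Solver.Ring differences (fromCommutativeRing R) ⟦⟧-morphism ⟦⟧-≟ public

module FieldProperties {f ℓ} (F : Field f ℓ) where
  open Field F
  open RingProperties ring using (x∙y⁻¹≈ε⇒x≈y)
  open SetoidReasoning setoid

  *-cancelˡ : ∀ {a x y} → a ≉ 0# → a * x ≈ a * y → x ≈ y
  *-cancelˡ {a} {x} {y} a≉0 ax≈ay with inverse a a≉0
  ... | a⁻¹ , aa⁻¹≈1 = begin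
    x                ≈⟨ *-identityˡ x ⟨
    1# * x           ≈⟨ *-congʳ (trans (sym aa⁻¹≈1) (*-comm a a⁻¹)) ⟩
    (a⁻¹ * a) * x    ≈⟨ *-assoc a⁻¹ a x ⟩
    a⁻¹ * (a * x)    ≈⟨ *-congˡ ax≈ay ⟩
    a⁻¹ * (a * y)    ≈⟨ *-assoc a⁻¹ a y ⟨
    (a⁻¹ * a) * y    ≈⟨ *-congʳ (trans (*-comm a⁻¹ a) aa⁻¹≈1) ⟩
    1# * y           ≈⟨ *-identityˡ y ⟩
    y                ∎

  x*y≈0⇒y≈0 : ∀ {x y} → x ≉ 0# → x * y ≈ 0# → y ≈ 0#
  x*y≈0⇒y≈0 {x} x≉0 xy≈0 = *-cancelˡ x≉0 (trans xy≈0 (sym (zeroʳ x)))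

  x≉0∧y≉0⇒x*y≉0 : ∀ {x y} → x ≉ 0# → y ≉ 0# → x * y ≉ 0#
  x≉0∧y≉0⇒x*y≉0 x≉0 y≉0 xy≈0 = y≉0 (x*y≈0⇒y≈0 x≉0 xy≈0)

  x≉y⇒x-y≉0 : ∀ {x y} → x ≉ y → x - y ≉ 0#
  x≉y⇒x-y≉0 {x} {y} x≉y x-y≈0 = x≉y (x∙y⁻¹≈ε⇒x≈y x y x-y≈0)

  x+y*z≈x : ∀ x y {z} → z ≈ 0# → x + y * z ≈ x
  x+y*z≈x x y z≈0 = trans (+-congˡ (trans (*-congˡ z≈0) (zeroʳ y))) (+-identityʳ x)

  x*y≈1⇒x*x*[y*z]≈x*z : ∀ {x y} z → x * y ≈ 1# → x * x * (y * z) ≈ x * z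
  x*y≈1⇒x*x*[y*z]≈x*z {x} {y} z xy≈1 = begin
    x * x * (y * z)     ≈⟨ *-assoc x x (y * z) ⟩
    x * (x * (y * z))   ≈⟨ *-congˡ (*-assoc x y z) ⟨
    x * (x * y * z)     ≈⟨ *-congˡ (*-congʳ xy≈1) ⟩
    x * (1# * z)        ≈⟨ *-congˡ (*-identityˡ z) ⟩
    x * z               ∎

module TribonacciSequences {f ℓ} (F : Field f ℓ) where
  open Field F
  open IntegerCoefficientSolver commutativeRing using (solve; _:=_; _:+_)
  open SetoidReasoning setoid

  IsTribonacci : (ℕ → Carrier) → Set ℓ
  IsTribonacci u = ∀ n → u (3 ℕ.+ n) ≈ u (2 ℕ.+ n) + u (1 ℕ.+ n) + u n

  T-isTribonacci : ∀ s₀ s₁ s₂ → IsTribonacci (T F s₀ s₁ s₂)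
  T-isTribonacci s₀ s₁ s₂ n = refl

  shift-isTribonacci : ∀ {u} → IsTribonacci u → IsTribonacci (λ n → u (suc n))
  shift-isTribonacci u-rec n = u-rec (suc n)

  +-isTribonacci : ∀ {u v} → IsTribonacci u → IsTribonacci v → IsTribonacci (λ n → u n + v n)
  +-isTribonacci {u} {v} u-rec v-rec n = begin
    u (3 ℕ.+ n) + v (3 ℕ.+ n)
      ≈⟨ +-cong (u-rec n) (v-rec n) ⟩
    (u (2 ℕ.+ n) + u (1 ℕ.+ n) + u n) + (v (2 ℕ.+ n) + v (1 ℕ.+ n) + v n)
      ≈⟨ solve 6 (λ u₂ u₁ u₀ v₂ v₁ v₀ → (u₂ :+ u₁ :+ u₀) :+ (v₂ :+ v₁ :+ v₀)
                                        := (u₂ :+ v₂) :+ (u₁ :+ v₁) :+ (u₀ :+ v₀)) refl _ _ _ _ _ _ ⟩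
    (u (2 ℕ.+ n) + v (2 ℕ.+ n)) + (u (1 ℕ.+ n) + v (1 ℕ.+ n)) + (u n + v n)
      ∎

  *-isTribonacci : ∀ k {u} → IsTribonacci u → IsTribonacci (λ n → k * u n)
  *-isTribonacci k {u} u-rec n = begin
    k * u (3 ℕ.+ n)                                ≈⟨ *-congˡ (u-rec n) ⟩
    k * (u (2 ℕ.+ n) + u (1 ℕ.+ n) + u n)          ≈⟨ distribˡ k _ _ ⟩
    k * (u (2 ℕ.+ n) + u (1 ℕ.+ n)) + k * u n      ≈⟨ +-congʳ (distribˡ k _ _) ⟩
    k * u (2 ℕ.+ n) + k * u (1 ℕ.+ n) + k * u n    ∎

  tribonacci-unique : ∀ {u v} → IsTribonacci u → IsTribonacci v →
                      u 0 ≈ v 0 → u 1 ≈ v 1 → u 2 ≈ v 2 → ∀ n → u n ≈ v n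
  tribonacci-unique {u} {v} u-rec v-rec u₀≈v₀ u₁≈v₁ u₂≈v₂ = go
    where
    go : ∀ n → u n ≈ v n
    go 0 = u₀≈v₀
    go 1 = u₁≈v₁
    go 2 = u₂≈v₂
    go (suc (suc (suc n))) = begin
      u (3 ℕ.+ n)                        ≈⟨ u-rec n ⟩
      u (2 ℕ.+ n) + u (1 ℕ.+ n) + u n    ≈⟨ +-cong (+-cong (go (suc (suc n))) (go (suc n))) (go n) ⟩
      v (2 ℕ.+ n) + v (1 ℕ.+ n) + v n    ≈⟨ v-rec n ⟨
      v (3 ℕ.+ n)                        ∎

  shiftCombination : Carrier → Carrier → Carrier → (ℕ → Carrier) → ℕ → Carrier
  shiftCombination a b c u n = a * u n + b * u (1 ℕ.+ n) + c * u (2 ℕ.+ n)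

  shiftCombination-isTribonacci : ∀ a b c {u} → IsTribonacci u → IsTribonacci (shiftCombination a b c u)
  shiftCombination-isTribonacci a b c u-rec =
    +-isTribonacci (+-isTribonacci (*-isTribonacci a u-rec) (*-isTribonacci b (shift-isTribonacci u-rec)))
                   (*-isTribonacci c (shift-isTribonacci (shift-isTribonacci u-rec)))

  shiftCombination-cong : ∀ a b c {u v} → (∀ n → u n ≈ v n) →
                          ∀ n → shiftCombination a b c u n ≈ shiftCombination a b c v n
  shiftCombination-cong a b c u≈v n =
    +-cong (+-cong (*-congˡ (u≈v n)) (*-congˡ (u≈v (1 ℕ.+ n)))) (*-congˡ (u≈v (2 ℕ.+ n)))

module CubicRoots {f ℓ} (F : Field f ℓ) where
  open Field F
  open FieldProperties F
  open TribonacciSequences F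
  open IntegerCoefficientSolver commutativeRing
  open RingProperties ring using (x≈y⇒x∙y⁻¹≈ε; -0#≈0#)
  open SetoidReasoning setoid

  cubic : Carrier → Carrier
  cubic x = pow F x 3 - pow F x 2 - x - 1#

  cubicᴾ : ∀ {n} → Polynomial n → Polynomial n
  cubicᴾ x = x :^ 3 :- x :^ 2 :- x :- con (1 ⊖ 0)

  cubic′ : Carrier → Carrier
  cubic′ x = fromℕ F 3 * (x * x) - fromℕ F 2 * x - 1#

  cubic′ᴾ : ∀ {n} → Polynomial n → Polynomial n
  cubic′ᴾ x = con (3 ⊖ 0) :* (x :* x) :- con (2 ⊖ 0) :* x :- con (1 ⊖ 0)

  dividedDifference : Carrier → Carrier → Carrier
  dividedDifference x y = x * x + x * y + y * y - x - y - 1#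

  dividedDifferenceᴾ : ∀ {n} → Polynomial n → Polynomial n → Polynomial n
  dividedDifferenceᴾ x y = x :* x :+ x :* y :+ y :* y :- x :- y :- con (1 ⊖ 0)

  σ₁ σ₂ : Carrier → Carrier → Carrier → Carrier
  σ₁ x y z = x + y + z
  σ₂ x y z = x * y + y * z + z * x

  σ₁ᴾ σ₂ᴾ : ∀ {n} → Polynomial n → Polynomial n → Polynomial n → Polynomial n
  σ₁ᴾ x y z = x :+ y :+ z
  σ₂ᴾ x y z = x :* y :+ y :* z :+ z :* x

  quadratic : Carrier → Carrier → Carrier → Carrier → Carrier
  quadratic a b c x = a + b * x + c * (x * x)

  quadraticᴾ : ∀ {n} → Polynomial n → Polynomial n → Polynomial n → Polynomial n → Polynomial n
  quadraticᴾ a b c x = a :+ b :* x :+ c :* (x :* x)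

  -- For a root x of the cubic: 44 x / cubic′ x and 44² (x / cubic′ x)³, reduced modulo the cubic.
  scaledCoefficient scaledCoefficientCube : Carrier → Carrier
  scaledCoefficient     = quadratic (- fromℕ F 8) (- fromℕ F 6) (fromℕ F 10)
  scaledCoefficientCube = quadratic (fromℕ F 28) (- fromℕ F 12) (fromℕ F 20)

  scaledCoefficientᴾ scaledCoefficientCubeᴾ : ∀ {n} → Polynomial n → Polynomial n
  scaledCoefficientᴾ     = quadraticᴾ (con (0 ⊖ 8)) (con (0 ⊖ 6)) (con (10 ⊖ 0))
  scaledCoefficientCubeᴾ = quadraticᴾ (con (28 ⊖ 0)) (con (0 ⊖ 12)) (con (20 ⊖ 0))

  dividedDifference-roots : ∀ {x y} → IsRoot F x → IsRoot F y → x ≉ y → dividedDifference x y ≈ 0#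
  dividedDifference-roots {x} {y} x-root y-root x≉y = x*y≈0⇒y≈0 (x≉y⇒x-y≉0 x≉y) (begin
    (x - y) * dividedDifference x y   ≈⟨ identity x y ⟩
    cubic x - cubic y                 ≈⟨ x≈y⇒x∙y⁻¹≈ε (trans x-root (sym y-root)) ⟩
    0#                                ∎)
    where
    identity : ∀ x y → (x - y) * dividedDifference x y ≈ cubic x - cubic y
    identity = solve 2 (λ x y → (x :- y) :* dividedDifferenceᴾ x y := cubicᴾ x :- cubicᴾ y) refl

  cubic′-inverse : ∀ {x e} → IsRoot F x → e * fromℕ F 44 ≈ 1# → cubic′ x * (e * scaledCoefficient x) ≈ x
  cubic′-inverse {x} {e} x-root e44≈1 = begin
    cubic′ x * (e * scaledCoefficient x)                                            ≈⟨ identity x e ⟩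
    x + e * (fromℕ F 30 * x - fromℕ F 8) * cubic x + x * (e * fromℕ F 44 - 1#)    ≈⟨ x+y*z≈x _ x (x≈y⇒x∙y⁻¹≈ε e44≈1) ⟩
    x + e * (fromℕ F 30 * x - fromℕ F 8) * cubic x                                 ≈⟨ x+y*z≈x x _ x-root ⟩
    x                                                                               ∎
    where
    identity : ∀ x e → cubic′ x * (e * scaledCoefficient x) ≈
               x + e * (fromℕ F 30 * x - fromℕ F 8) * cubic x + x * (e * fromℕ F 44 - 1#)
    identity = solve 2 (λ x e → cubic′ᴾ x :* (e :* scaledCoefficientᴾ x)
                              := x :+ e :* (con (30 ⊖ 0) :* x :- con (8 ⊖ 0)) :* cubicᴾ x
                                   :+ x :* (e :* con (44 ⊖ 0) :- con (1 ⊖ 0))) refl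

  cube-of-scaledCoefficient : ∀ {x e c} → IsRoot F x → e * fromℕ F 44 ≈ 1# → c ≈ e * scaledCoefficient x →
                              pow F c 3 ≈ e * e * scaledCoefficientCube x
  cube-of-scaledCoefficient {x} {e} {c} x-root e44≈1 c≈eP = begin
    pow F c 3                                  ≈⟨ *-cong c≈eP (*-cong c≈eP (*-congʳ c≈eP)) ⟩
    pow F (e * scaledCoefficient x) 3          ≈⟨ identity x e ⟩
    e * e * Q + e * e * e * quotient x * cubic x + e * e * Q * (e * fromℕ F 44 - 1#)
                                               ≈⟨ x+y*z≈x _ _ (x≈y⇒x∙y⁻¹≈ε e44≈1) ⟩
    e * e * Q + e * e * e * quotient x * cubic x
                                               ≈⟨ x+y*z≈x _ _ x-root ⟩
    e * e * Q                                  ∎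
    where
    Q : Carrier
    Q = scaledCoefficientCube x
    quotient : Carrier → Carrier
    quotient x = fromℕ F 1744 - fromℕ F 1120 * x - fromℕ F 800 * (x * x) + fromℕ F 1000 * (x * (x * x))
    identity : ∀ x e → pow F (e * scaledCoefficient x) 3 ≈
               e * e * scaledCoefficientCube x + e * e * e * quotient x * cubic x
                 + e * e * scaledCoefficientCube x * (e * fromℕ F 44 - 1#)
    identity = solve 2 (λ x e →
      (e :* scaledCoefficientᴾ x) :^ 3
        := e :* e :* scaledCoefficientCubeᴾ x
           :+ e :* e :* e :* (con (1744 ⊖ 0) :- con (1120 ⊖ 0) :* x :- con (800 ⊖ 0) :* (x :* x)
                              :+ con (1000 ⊖ 0) :* (x :* (x :* x))) :* cubicᴾ x
           :+ e :* e :* scaledCoefficientCubeᴾ x :* (e :* con (44 ⊖ 0) :- con (1 ⊖ 0))) refl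

  pow-isTribonacci : ∀ {x} → IsRoot F x → IsTribonacci (pow F x)
  pow-isTribonacci {x} x-root n = begin
    x * (x * (x * w))                       ≈⟨ identity x w ⟩
    x * (x * w) + x * w + w + w * cubic x   ≈⟨ x+y*z≈x _ w x-root ⟩
    x * (x * w) + x * w + w                 ∎
    where
    w : Carrier
    w = pow F x n
    identity : ∀ x w → x * (x * (x * w)) ≈ x * (x * w) + x * w + w + w * cubic x
    identity = solve 2 (λ x w → x :* (x :* (x :* w)) := x :* (x :* w) :+ x :* w :+ w :+ w :* cubicᴾ x) refl

  powerSum : Carrier → Carrier → Carrier → ℕ → Carrier
  powerSum x y z n = pow F x n + pow F y n + pow F z n

  powerSum-isTribonacci : ∀ {x y z} → IsRoot F x → IsRoot F y → IsRoot F z → IsTribonacci (powerSum x y z)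
  powerSum-isTribonacci x-root y-root z-root =
    +-isTribonacci (+-isTribonacci (pow-isTribonacci x-root) (pow-isTribonacci y-root)) (pow-isTribonacci z-root)

  shiftCombination-powerSum : ∀ a b c x y z n →
    shiftCombination a b c (powerSum x y z) n ≈
    quadratic a b c x * pow F x n + quadratic a b c y * pow F y n + quadratic a b c z * pow F z n
  shiftCombination-powerSum a b c x y z n = solve 9
    (λ a b c x y z X Y Z →
      a :* (X :+ Y :+ Z) :+ b :* (x :* X :+ y :* Y :+ z :* Z) :+ c :* (x :* (x :* X) :+ y :* (y :* Y) :+ z :* (z :* Z))
        := quadraticᴾ a b c x :* X :+ quadraticᴾ a b c y :* Y :+ quadraticᴾ a b c z :* Z)
    refl a b c x y z (pow F x n) (pow F y n) (pow F z n)

  shiftCombination-T≈44*T : ∀ n →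
    shiftCombination (fromℕ F 28) (- fromℕ F 12) (fromℕ F 20) (T F (fromℕ F 3) 1# (fromℕ F 3)) n ≈
    fromℕ F 44 * T F (fromℕ F 3) (fromℕ F 3) (fromℕ F 5) n
  shiftCombination-T≈44*T = tribonacci-unique
    (shiftCombination-isTribonacci _ _ _ (T-isTribonacci _ _ _)) (*-isTribonacci _ (T-isTribonacci _ _ _))
    (solve 0 (k₂₈ :* k₃ :+ k₋₁₂ :* k₁ :+ k₂₀ :* k₃ := k₄₄ :* k₃) refl)
    (solve 0 (k₂₈ :* k₁ :+ k₋₁₂ :* k₃ :+ k₂₀ :* (k₃ :+ k₁ :+ k₃) := k₄₄ :* k₃) refl)
    (solve 0 (k₂₈ :* k₃ :+ k₋₁₂ :* (k₃ :+ k₁ :+ k₃) :+ k₂₀ :* ((k₃ :+ k₁ :+ k₃) :+ k₃ :+ k₁) := k₄₄ :* k₅) refl)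
    where
    k₁ k₃ k₅ k₂₀ k₂₈ k₋₁₂ k₄₄ : Polynomial 0
    k₁   = con (1 ⊖ 0)
    k₃   = con (3 ⊖ 0)
    k₅   = con (5 ⊖ 0)
    k₂₀  = con (20 ⊖ 0)
    k₂₈  = con (28 ⊖ 0)
    k₋₁₂ = con (0 ⊖ 12)
    k₄₄  = con (44 ⊖ 0)

  module DistinctRoots {x y z} (x-root : IsRoot F x) (y-root : IsRoot F y) (z-root : IsRoot F z)
               (x≉y : x ≉ y) (x≉z : x ≉ z) (y≉z : y ≉ z) where

    σ₁-1≈0 : σ₁ x y z - 1# ≈ 0#
    σ₁-1≈0 = x*y≈0⇒y≈0 (x≉y⇒x-y≉0 y≉z) (begin
      (y - z) * (σ₁ x y z - 1#)                      ≈⟨ identity x y z ⟩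
      dividedDifference x y - dividedDifference x z  ≈⟨ x≈y⇒x∙y⁻¹≈ε (trans (dividedDifference-roots x-root y-root x≉y)
                                                                           (sym (dividedDifference-roots x-root z-root x≉z))) ⟩
      0#                                             ∎)
      where
      identity : ∀ x y z → (y - z) * (σ₁ x y z - 1#) ≈ dividedDifference x y - dividedDifference x z
      identity = solve 3 (λ x y z → (y :- z) :* (σ₁ᴾ x y z :- con (1 ⊖ 0))
                                  := dividedDifferenceᴾ x y :- dividedDifferenceᴾ x z) refl

    σ₂+1≈0 : σ₂ x y z + 1# ≈ 0#
    σ₂+1≈0 = begin
      σ₂ x y z + 1#                                         ≈⟨ identity x y z ⟩
      - dividedDifference x y + (x + y) * (σ₁ x y z - 1#)   ≈⟨ x+y*z≈x _ (x + y) σ₁-1≈0 ⟩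
      - dividedDifference x y                               ≈⟨ -‿cong (dividedDifference-roots x-root y-root x≉y) ⟩
      - 0#                                                  ≈⟨ -0#≈0# ⟩
      0#                                                    ∎
      where
      identity : ∀ x y z → σ₂ x y z + 1# ≈ - dividedDifference x y + (x + y) * (σ₁ x y z - 1#)
      identity = solve 3 (λ x y z → σ₂ᴾ x y z :+ con (1 ⊖ 0)
                                  := :- dividedDifferenceᴾ x y :+ (x :+ y) :* (σ₁ᴾ x y z :- con (1 ⊖ 0))) refl

    [x-y][x-z]≈cubic′ : (x - y) * (x - z) ≈ cubic′ x
    [x-y][x-z]≈cubic′ = begin
      (x - y) * (x - z)                                                         ≈⟨ identity x y z ⟩
      cubic′ x + - (fromℕ F 2 * x) * (σ₁ x y z - 1#) + 1# * (σ₂ x y z + 1#)     ≈⟨ x+y*z≈x _ 1# σ₂+1≈0 ⟩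
      cubic′ x + - (fromℕ F 2 * x) * (σ₁ x y z - 1#)                            ≈⟨ x+y*z≈x _ _ σ₁-1≈0 ⟩
      cubic′ x                                                                  ∎
      where
      identity : ∀ x y z → (x - y) * (x - z) ≈
                 cubic′ x + - (fromℕ F 2 * x) * (σ₁ x y z - 1#) + 1# * (σ₂ x y z + 1#)
      identity = solve 3 (λ x y z → (x :- y) :* (x :- z)
                                  := cubic′ᴾ x :+ :- (con (2 ⊖ 0) :* x) :* (σ₁ᴾ x y z :- con (1 ⊖ 0))
                                       :+ con (1 ⊖ 0) :* (σ₂ᴾ x y z :+ con (1 ⊖ 0))) refl

    coefficient≈ : ∀ {c e} → e * fromℕ F 44 ≈ 1# → c * ((x - y) * (x - z)) ≈ x → c ≈ e * scaledCoefficient x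
    coefficient≈ {c} {e} e44≈1 c-def = *-cancelˡ (x≉0∧y≉0⇒x*y≉0 (x≉y⇒x-y≉0 x≉y) (x≉y⇒x-y≉0 x≉z)) (begin
      (x - y) * (x - z) * c                           ≈⟨ *-comm _ c ⟩
      c * ((x - y) * (x - z))                         ≈⟨ c-def ⟩
      x                                               ≈⟨ cubic′-inverse x-root e44≈1 ⟨
      cubic′ x * (e * scaledCoefficient x)            ≈⟨ *-congʳ [x-y][x-z]≈cubic′ ⟨
      (x - y) * (x - z) * (e * scaledCoefficient x)   ∎)

    coefficient³≈ : ∀ {c e} → e * fromℕ F 44 ≈ 1# → c * ((x - y) * (x - z)) ≈ x →
                    pow F c 3 ≈ e * e * scaledCoefficientCube x
    coefficient³≈ e44≈1 c-def = cube-of-scaledCoefficient x-root e44≈1 (coefficient≈ e44≈1 c-def)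

    powerSum≈T : ∀ n → powerSum x y z n ≈ T F (fromℕ F 3) 1# (fromℕ F 3) n
    powerSum≈T = tribonacci-unique (powerSum-isTribonacci x-root y-root z-root) (T-isTribonacci _ _ _)
      (solve 0 (con (1 ⊖ 0) :+ con (1 ⊖ 0) :+ con (1 ⊖ 0) := con (3 ⊖ 0)) refl)
      (begin
        x * 1# + y * 1# + z * 1#      ≈⟨ identity₁ x y z ⟩
        1# + 1# * (σ₁ x y z - 1#)     ≈⟨ x+y*z≈x _ _ σ₁-1≈0 ⟩
        1#                            ∎)
      (begin
        pow F x 2 + pow F y 2 + pow F z 2
          ≈⟨ identity₂ x y z ⟩
        fromℕ F 3 + (σ₁ x y z + 1#) * (σ₁ x y z - 1#) + - fromℕ F 2 * (σ₂ x y z + 1#)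
          ≈⟨ x+y*z≈x _ _ σ₂+1≈0 ⟩
        fromℕ F 3 + (σ₁ x y z + 1#) * (σ₁ x y z - 1#)
          ≈⟨ x+y*z≈x _ _ σ₁-1≈0 ⟩
        fromℕ F 3
          ∎)
      where
      identity₁ : ∀ x y z → x * 1# + y * 1# + z * 1# ≈ 1# + 1# * (σ₁ x y z - 1#)
      identity₁ = solve 3 (λ x y z → x :* con (1 ⊖ 0) :+ y :* con (1 ⊖ 0) :+ z :* con (1 ⊖ 0)
                                   := con (1 ⊖ 0) :+ con (1 ⊖ 0) :* (σ₁ᴾ x y z :- con (1 ⊖ 0))) refl
      identity₂ : ∀ x y z → pow F x 2 + pow F y 2 + pow F z 2 ≈
                  fromℕ F 3 + (σ₁ x y z + 1#) * (σ₁ x y z - 1#) + - fromℕ F 2 * (σ₂ x y z + 1#)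
      identity₂ = solve 3 (λ x y z → x :^ 2 :+ y :^ 2 :+ z :^ 2
                                   := con (3 ⊖ 0) :+ (σ₁ᴾ x y z :+ con (1 ⊖ 0)) :* (σ₁ᴾ x y z :- con (1 ⊖ 0))
                                        :+ con (0 ⊖ 2) :* (σ₂ᴾ x y z :+ con (1 ⊖ 0))) refl

lemma7 : ∀ {c ℓ} (F : Field c ℓ) → CharZero F →
    let open Field F in
    (α β γ : Carrier) →
    IsRoot F α → IsRoot F β → IsRoot F γ →
    ¬ (α ≈ β) → ¬ (α ≈ γ) → ¬ (β ≈ γ) →
    (c₁ c₂ c₃ e : Carrier) →
    c₁ * ((α - β) * (α - γ)) ≈ α →
    c₂ * ((β - α) * (β - γ)) ≈ β →
    c₃ * ((γ - α) * (γ - β)) ≈ γ →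
    e * fromℕ F 44 ≈ 1# →
    (n : ℕ) →
      pow F c₁ 3 * pow F α n + pow F c₂ 3 * pow F β n + pow F c₃ 3 * pow F γ n
        ≈ e * T F (fromℕ F 3) (fromℕ F 3) (fromℕ F 5) n
lemma7 F _ α β γ α-root β-root γ-root α≉β α≉γ β≉γ c₁ c₂ c₃ e c₁-def c₂-def c₃-def e44≈1 n = begin
  pow F c₁ 3 * pow F α n + pow F c₂ 3 * pow F β n + pow F c₃ 3 * pow F γ n
    ≈⟨ +-cong (+-cong (*-congʳ (Rα.coefficient³≈ e44≈1 c₁-def)) (*-congʳ (Rβ.coefficient³≈ e44≈1 c₂-def)))
              (*-congʳ (Rγ.coefficient³≈ e44≈1 c₃-def)) ⟩
  e * e * Q α * pow F α n + e * e * Q β * pow F β n + e * e * Q γ * pow F γ n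
    ≈⟨ solve 7 (λ k a b c x y z → k :* a :* x :+ k :* b :* y :+ k :* c :* z := k :* (a :* x :+ b :* y :+ c :* z))
               refl (e * e) (Q α) (Q β) (Q γ) (pow F α n) (pow F β n) (pow F γ n) ⟩
  e * e * (Q α * pow F α n + Q β * pow F β n + Q γ * pow F γ n)
    ≈⟨ *-congˡ (shiftCombination-powerSum _ _ _ α β γ n) ⟨
  e * e * shiftCombination (fromℕ F 28) (- fromℕ F 12) (fromℕ F 20) (powerSum α β γ) n
    ≈⟨ *-congˡ (trans (shiftCombination-cong _ _ _ Rα.powerSum≈T n) (shiftCombination-T≈44*T n)) ⟩
  e * e * (fromℕ F 44 * T F (fromℕ F 3) (fromℕ F 3) (fromℕ F 5) n)
    ≈⟨ x*y≈1⇒x*x*[y*z]≈x*z _ e44≈1 ⟩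
  e * T F (fromℕ F 3) (fromℕ F 3) (fromℕ F 5) n
    ∎
  where
  open Field F
  open FieldProperties F
  open TribonacciSequences F
  open CubicRoots F
  open IntegerCoefficientSolver commutativeRing using (solve; _:=_; _:+_; _:*_)
  open SetoidReasoning setoid
  Q : Carrier → Carrier
  Q = scaledCoefficientCube
  module Rα = DistinctRoots α-root β-root γ-root α≉β α≉γ β≉γ
  module Rβ = DistinctRoots β-root α-root γ-root (α≉β ∘ sym) β≉γ α≉γ
  module Rγ = DistinctRoots γ-root α-root β-root (α≉γ ∘ sym) (β≉γ ∘ sym) α≉β
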